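{- Let $t\in K$. Define $d^\lambda_{\mu\nu}$ and $c^\lambda_{\mu\nu}$ by $g_\mu g_\nu=\sum_\lambda d^\lambda_{\mu\nu}g_\lambda$ and $g_{\lambda/\mu}=\sum_\nu c^\lambda_{\mu\nu}g_\nu$. Then (1) for all partitions $\mu,\nu$, $t^{c(\mu)+c(\nu)}=\sum_\lambda d^\lambda_{\mu\nu}t^{c(\lambda)}$; (2) for all partitions $\mu\subset\lambda$, $t^{c(\lambda/\mu)}=\sum_\nu c^\lambda_{\mu\nu}t^{c(\nu)}$.
   Context: $K$ is a commutative ring, $\Lambda$ the ring of symmetric functions of bounded degree over $K$ in $x=(x_1,x_2,\dots)$. For partitions $\mu\subset\lambda$, $g_{\lambda/\mu}=\sum_T\prod_ix_i^{T(i)}$ over fillings $T$ of $\lambda/\mu$ by positive integers weakly increasing in rows and columns, $T(i)$ the number of columns containing $i$; $g_\lambda=g_{\lambda/\emptyset}$; $g_{\lambda/\mu}\in\Lambda$ and $\{g_\lambda\}$ is a basis of $\Lambda$. $c(\lambda/\mu)$ is the number of nonempty columns of the skew shape $\lambda/\mu$, and $c(\lambda)=c(\lambda/\emptyset)=\lambda_1$. -}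

module Defs where

open import Level using (_⊔_)
open import Algebra.Bundles using (CommutativeRing)
open import Data.Bool using (Bool; true; false; _∧_; _∨_; if_then_else_)
open import Data.Nat using (ℕ; zero; suc; _∸_; _≤_; _<_; _≥_; _≤ᵇ_; _<ᵇ_; _≡ᵇ_)
open import Data.List using (List; []; _∷_; [_]; map; concatMap; applyUpTo; upTo; length; filterᵇ; foldr)
open import Data.Bool.ListAction using (all; any)
open import Data.List.Relation.Unary.All using (All)
open import Data.List.Relation.Unary.Linked using (Linked)
open import Data.Maybe using (Maybe; just; nothing)
open import Data.Product using (_×_; _,_)

-- i-th entry (0-based) of a list of naturals, 0 beyond its length
part : List ℕ → ℕ → ℕ
part []       _       = 0
part (x ∷ xs) zero    = x
part (x ∷ xs) (suc i) = part xs i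

nthRow : List (List ℕ) → ℕ → List ℕ
nthRow []       _       = []
nthRow (r ∷ rs) zero    = r
nthRow (r ∷ rs) (suc i) = nthRow rs i

record Partition : Set where
  constructor mkPartition
  field
    parts      : List ℕ
    decreasing : Linked _≥_ parts
    positive   : All (λ k → 0 < k) parts
open Partition public

emptyPartition : Partition
emptyPartition = mkPartition [] Linked.[] All.[]

_⊆ₚ_ : Partition → Partition → Set
μ ⊆ₚ la = ∀ i → part (parts μ) i ≤ part (parts la) i

-- c(λ) = λ₁ (number of columns)
cols : Partition → ℕ
cols la = part (parts la) 0

count : {A : Set} → (A → Bool) → List A → ℕ
count p xs = length (filterᵇ p xs)

-- cell (i , j) (0-based row, column) lies in λ/μ
inSkew : Partition → Partition → ℕ → ℕ → Bool
inSkew la μ i j = (part (parts μ) i ≤ᵇ j) ∧ (j <ᵇ part (parts la) i)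

-- c(λ/μ): number of nonempty columns of λ/μ
colsSkew : Partition → Partition → ℕ
colsSkew la μ = count (λ j → any (λ i → inSkew la μ i j) (upTo (length (parts la)))) (upTo (cols la))

-- Fillings of λ/μ with entries in {1,…,n}: row i is the list of entries
-- of the cells (i, μᵢ), …, (i, λᵢ - 1).

Filling : Set
Filling = List (List ℕ)

words : ℕ → ℕ → List (List ℕ)
words n zero    = [ [] ]
words n (suc k) = concatMap (λ a → map (a ∷_) (words n k)) (applyUpTo suc n)

rowLengths : Partition → Partition → List ℕ
rowLengths la μ = map (λ i → part (parts la) i ∸ part (parts μ) i) (upTo (length (parts la)))

allFillings : ℕ → List ℕ → List Filling
allFillings n = foldr (λ k acc → concatMap (λ w → map (w ∷_) acc) (words n k)) [ [] ]

entry : Partition → Partition → Filling → ℕ → ℕ → Maybe ℕ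
entry la μ T i j =
  if inSkew la μ i j then just (part (nthRow T i) (j ∸ part (parts μ) i)) else nothing

leM : Maybe ℕ → Maybe ℕ → Bool
leM (just a) (just b) = a ≤ᵇ b
leM _        _        = true

eqM : Maybe ℕ → ℕ → Bool
eqM (just a) k = a ≡ᵇ k
eqM nothing  k = false

valid : Partition → Partition → Filling → Bool
valid la μ T =
  all (λ i → all (λ j → leM (e i j) (e i (suc j)) ∧ leM (e i j) (e (suc i) j))
                 (upTo (cols la)))
      (upTo (length (parts la)))
  where e = entry la μ T

colCount : Partition → Partition → Filling → ℕ → ℕ
colCount la μ T k =
  count (λ j → any (λ i → eqM (entry la μ T i j) k) (upTo (length (parts la)))) (upTo (cols la))

weight : ℕ → Partition → Partition → Filling → List ℕ
weight n la μ T = map (colCount la μ T) (applyUpTo suc n)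

eqL : List ℕ → List ℕ → Bool
eqL []       []       = true
eqL (a ∷ as) (b ∷ bs) = (a ≡ᵇ b) ∧ eqL as bs
eqL _        _        = false

-- coefficient of x^α in g_{λ/μ}, where α = (α₁,…,αₙ) is an exponent vector
-- (monomial x₁^α₁ ⋯ xₙ^αₙ); it counts fillings T of λ/μ with T(i) = αᵢ.
-- (A filling using an entry k > n would give a positive exponent of x_k, so
-- only entries in {1,…,n} are relevant.)
gCoeffℕ : Partition → Partition → List ℕ → ℕ
gCoeffℕ la μ α =
  count (λ T → valid la μ T ∧ eqL (weight (length α) la μ T) α)
        (allFillings (length α) (rowLengths la μ))

splits : List ℕ → List (List ℕ × List ℕ)
splits []       = [ ([] , []) ]
splits (a ∷ as) =
  concatMap (λ b → map (λ { (β , γ) → (b ∷ β , (a ∸ b) ∷ γ) }) (splits as)) (upTo (suc a))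

-- Formal power series in x₁, x₂, … over K, as coefficient functions on
-- exponent vectors; g_{λ/μ}, products and finite linear combinations.

module WithRing {c ℓ} (K : CommutativeRing c ℓ) where
  open CommutativeRing K

  Series : Set c
  Series = List ℕ → Carrier

  fromℕ : ℕ → Carrier
  fromℕ zero    = 0#
  fromℕ (suc n) = 1# + fromℕ n

  pow : Carrier → ℕ → Carrier
  pow t zero    = 1#
  pow t (suc n) = t * pow t n

  sumK : List Carrier → Carrier
  sumK = foldr _+_ 0#

  _≈ˢ_ : Series → Series → Set ℓ
  f ≈ˢ h = ∀ α → f α ≈ h α

  gSkew : Partition → Partition → Series
  gSkew la μ α = fromℕ (gCoeffℕ la μ α)

  g : Partition → Series
  g la = gSkew la emptyPartition

  _⋆_ : Series → Series → Series
  (f ⋆ h) α = sumK (map (λ { (β , γ) → f β * h γ }) (splits α))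

  combo : List (Partition × Carrier) → Series
  combo L α = sumK (map (λ { (la , a) → a * g la α }) L)

  comboEval : Carrier → List (Partition × Carrier) → Carrier
  comboEval t L = sumK (map (λ { (la , a) → a * pow t (cols la) }) L)

-- Specialise x₁ ↦ t and x₂ = x₃ = ⋯ = 0. With the single letter 1 the only
-- filling of λ/μ is the all-ones one; it is semistandard and has T(1) = c(λ/μ),
-- so g_{λ/μ}(t, 0, 0, …) = t^{c(λ/μ)}. The specialisation only sees the
-- coefficients of the powers of x₁ and is multiplicative on them, so applying it
-- to the two defining expansions gives both identities. On series given by
-- coefficient functions it is the finite sum Σ_{n<N} [x₁ⁿ]f · tⁿ, with N beyond
-- every column count that occurs.
module Submission where

open import Defs
open import Algebra.Bundles using (CommutativeRing)
open import Data.Bool using (Bool; true; false; T; _∧_; if_then_else_)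
open import Data.Bool.Properties using (T-≡; T-∧; T-∨; ∧-identityʳ)
open import Data.Bool.ListAction using (any; or)
open import Data.Fin using (Fin; toℕ; fromℕ<)
open import Data.Fin.Properties using (toℕ-fromℕ<; toℕ-injective; toℕ≤pred[n]; punchInᵢ≢i)
open import Data.List using (List; []; _∷_; [_]; map; applyUpTo; upTo; length; replicate; concat; foldr)
open import Data.List.Properties using (map-cong; map-∘; map-upTo; concatMap-pure; filter-all; filter-≐; length-upTo)
open import Data.List.Relation.Unary.All as All using (All)
open import Data.List.Relation.Unary.All.Properties using (all⁻; all-upTo)
open import Data.Maybe using (Maybe; just; nothing)
import Data.Nat as ℕ
open import Data.Nat using (ℕ; zero; suc; _∸_; _≤_; _<_; _⊔_; _≡ᵇ_; z≤n; s≤s)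
open import Data.Nat.Properties
  using (_≟_; ≤ᵇ⇒≤; <ᵇ⇒<; <⇒<ᵇ; ∸-monoˡ-<; m+n∸m≡n; m+[n∸m]≡n; m≤m+n; m≤m⊔n; m≤n⊔m; ≤-trans)
open import Data.Product using (_×_; _,_; proj₁; proj₂)
open import Data.Sum using (inj₁)
open import Data.Vec.Functional using (Vector; removeAt)
open import Function using (_∘_; _⇔_; Equivalence; mk⇔)
open import Relation.Nullary using (does; yes; no; T?)
open import Relation.Nullary.Decidable using (dec-true; dec-false; does-⇔)
open import Relation.Binary.PropositionalEquality as ≡ using (_≡_; _≢_; _≗_; refl; module ≡-Reasoning)

module _ {A : Set} where

  count-[_] : (p : A → Bool) (x : A) → count p [ x ] ≡ (if p x then 1 else 0)
  count-[_] p x with p x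
  ... | true  = refl
  ... | false = refl

  count-cong : {p q : A → Bool} → p ≗ q → count p ≗ count q
  count-cong {p} {q} p≗q =
    ≡.cong length ∘ filter-≐ (T? ∘ p) (T? ∘ q) ((λ {x} → ≡.subst T (p≗q x)) , (λ {x} → ≡.subst T (≡.sym (p≗q x))))

  count-all : (p : A → Bool) {xs : List A} → All (T ∘ p) xs → count p xs ≡ length xs
  count-all p = ≡.cong length ∘ filter-all (T? ∘ p)

  any-cong : {p q : A → Bool} → p ≗ q → any p ≗ any q
  any-cong p≗q = ≡.cong or ∘ map-cong p≗q

nthRow-applyUpTo : (f : ℕ → List ℕ) {m i : ℕ} → i < m → nthRow (applyUpTo f m) i ≡ f i
nthRow-applyUpTo f {suc m} {zero}  _         = refl
nthRow-applyUpTo f {suc m} {suc i} (s≤s i<m) = nthRow-applyUpTo (f ∘ suc) i<m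

part-replicate : {m i k : ℕ} → i < m → part (replicate m k) i ≡ k
part-replicate {suc m} {zero}  _         = refl
part-replicate {suc m} {suc i} (s≤s i<m) = part-replicate i<m

part-positive⇒<length : (xs : List ℕ) {i : ℕ} → 0 < part xs i → i < length xs
part-positive⇒<length (x ∷ xs) {zero}  _   = s≤s z≤n
part-positive⇒<length (x ∷ xs) {suc i} pos = s≤s (part-positive⇒<length xs pos)

inSkew⇒bounds : (la μ : Partition) {i j : ℕ} → T (inSkew la μ i j) →
                part (parts μ) i ≤ j × j < part (parts la) i
inSkew⇒bounds la μ {i} {j} cell with Equivalence.to T-∧ cell
... | lower , upper = ≤ᵇ⇒≤ _ _ lower , <ᵇ⇒< _ _ upper

words-1 : (k : ℕ) → words 1 k ≡ [ replicate k 1 ]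
words-1 zero    = refl
words-1 (suc k) rewrite words-1 k = refl

onesFilling : Partition → Partition → Filling
onesFilling la μ = map (λ k → replicate k 1) (rowLengths la μ)

allFillings-1 : (ls : List ℕ) → allFillings 1 ls ≡ [ map (λ k → replicate k 1) ls ]
allFillings-1 []       = refl
allFillings-1 (k ∷ ls) rewrite words-1 k | allFillings-1 ls = refl

oneEntryIf : Bool → Maybe ℕ
oneEntryIf b = if b then just 1 else nothing

entry-onesFilling : (la μ : Partition) (i j : ℕ) →
                    entry la μ (onesFilling la μ) i j ≡ oneEntryIf (inSkew la μ i j)
entry-onesFilling la μ i j with inSkew la μ i j in cell
... | false = refl
... | true  = ≡.cong just (begin
    part (nthRow (onesFilling la μ) i) (j ∸ μᵢ)  ≡⟨ ≡.cong (λ T → part (nthRow T i) (j ∸ μᵢ)) rows ⟩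
    part (nthRow (applyUpTo row ℓ) i) (j ∸ μᵢ)   ≡⟨ ≡.cong (λ r → part r (j ∸ μᵢ)) (nthRow-applyUpTo row i<ℓ) ⟩
    part (row i) (j ∸ μᵢ)                        ≡⟨ part-replicate (∸-monoˡ-< j<λᵢ μᵢ≤j) ⟩
    1                                            ∎)
  where
    open ≡-Reasoning
    μᵢ = part (parts μ) i
    ℓ = length (parts la)
    row : ℕ → List ℕ
    row i = replicate (part (parts la) i ∸ part (parts μ) i) 1
    rows : onesFilling la μ ≡ applyUpTo row ℓ
    rows = ≡.trans (≡.sym (map-∘ (upTo ℓ))) (map-upTo row ℓ)
    bounds = inSkew⇒bounds la μ (Equivalence.from T-≡ cell)
    μᵢ≤j = proj₁ bounds
    j<λᵢ = proj₂ bounds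
    i<ℓ : i < ℓ
    i<ℓ = part-positive⇒<length (parts la) (≤-trans (s≤s z≤n) j<λᵢ)

leM-oneEntryIf : (b b′ : Bool) → T (leM (oneEntryIf b) (oneEntryIf b′))
leM-oneEntryIf true  true  = _
leM-oneEntryIf true  false = _
leM-oneEntryIf false _     = _

valid-onesFilling : (la μ : Partition) → T (valid la μ (onesFilling la μ))
valid-onesFilling la μ =
  all⁻ _ (All.universal (λ i → all⁻ _ (All.universal (λ j →
    Equivalence.from T-∧ (monotone i j i (suc j) , monotone i j (suc i) j)) (upTo (cols la))))
    (upTo (length (parts la))))
  where
    monotone : (i j i′ j′ : ℕ) →
               T (leM (entry la μ (onesFilling la μ) i j) (entry la μ (onesFilling la μ) i′ j′))
    monotone i j i′ j′ rewrite entry-onesFilling la μ i j | entry-onesFilling la μ i′ j′ =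
      leM-oneEntryIf (inSkew la μ i j) (inSkew la μ i′ j′)

eqM-oneEntryIf-1 : (b : Bool) → eqM (oneEntryIf b) 1 ≡ b
eqM-oneEntryIf-1 true  = refl
eqM-oneEntryIf-1 false = refl

colCount-onesFilling : (la μ : Partition) → colCount la μ (onesFilling la μ) 1 ≡ colsSkew la μ
colCount-onesFilling la μ = count-cong (λ j → any-cong (λ i →
    ≡.trans (≡.cong (λ e → eqM e 1) (entry-onesFilling la μ i j)) (eqM-oneEntryIf-1 _))
    (upTo (length (parts la)))) (upTo (cols la))

gCoeffℕ-oneVariable : (la μ : Partition) (n : ℕ) →
                      gCoeffℕ la μ (n ∷ []) ≡ (if colsSkew la μ ≡ᵇ n then 1 else 0)
gCoeffℕ-oneVariable la μ n = begin
  count P (allFillings 1 (rowLengths la μ)) ≡⟨ ≡.cong (count P) (allFillings-1 (rowLengths la μ)) ⟩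
  count P [ onesFilling la μ ]              ≡⟨ count-[ P ] (onesFilling la μ) ⟩
  (if P (onesFilling la μ) then 1 else 0)   ≡⟨ ≡.cong (λ b → if b then 1 else 0) P-onesFilling ⟩
  (if colsSkew la μ ≡ᵇ n then 1 else 0)     ∎
  where
    open ≡-Reasoning
    P : Filling → Bool
    P T = valid la μ T ∧ eqL (weight 1 la μ T) (n ∷ [])
    P-onesFilling : P (onesFilling la μ) ≡ (colsSkew la μ ≡ᵇ n)
    P-onesFilling = ≡.cong₂ _∧_ (Equivalence.to T-≡ (valid-onesFilling la μ))
                              (≡.trans (∧-identityʳ _) (≡.cong (_≡ᵇ n) (colCount-onesFilling la μ)))

colsSkew-∅ : (la : Partition) → colsSkew la emptyPartition ≡ cols la
colsSkew-∅ (mkPartition []       _ _) = refl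
colsSkew-∅ (mkPartition (x ∷ xs) _ _) =
  ≡.trans (count-all _ (All.map (Equivalence.from T-∨ ∘ inj₁ ∘ <⇒<ᵇ) (all-upTo x))) (length-upTo x)

splitAt : ℕ → ℕ → List ℕ × List ℕ
splitAt n b = b ∷ [] , (n ∸ b) ∷ []

splits-singleton : (n : ℕ) → splits (n ∷ []) ≡ applyUpTo (splitAt n) (suc n)
splits-singleton n = ≡.trans (≡.cong concat (map-∘ {g = [_]} {f = splitAt n} (upTo (suc n))))
                             (≡.trans (concatMap-pure (map (splitAt n) (upTo (suc n))))
                                      (map-upTo (splitAt n) (suc n)))

module _ {c ℓ} (K : CommutativeRing c ℓ) where
  open CommutativeRing K hiding (refl)
  open WithRing K
  open import Algebra.Properties.Semiring.Sum semiring
    using (sum; sum-syntax; sum-cong-≋; sum-replicate-zero; sum-remove; ∑-distrib-+; *-distribˡ-sum)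
  open import Relation.Binary.Reasoning.Setoid setoid

  sum-zero : {N : ℕ} (f : Vector Carrier N) → (∀ i → f i ≈ 0#) → sum f ≈ 0#
  sum-zero {N} f f≈0 = trans (sum-cong-≋ f≈0) (sum-replicate-zero N)

  sum-δ : {N : ℕ} (f : Vector Carrier N) (k : Fin N) → (∀ i → i ≢ k → f i ≈ 0#) → sum f ≈ f k
  sum-δ {suc N} f k f≈0 = begin
    sum f                    ≈⟨ sum-remove f ⟩
    f k + sum (removeAt f k) ≈⟨ +-congˡ (sum-zero _ (λ i → f≈0 _ (punchInᵢ≢i k i))) ⟩
    f k + 0#                 ≈⟨ +-identityʳ (f k) ⟩
    f k                      ∎

  sum-δℕ : {N k : ℕ} (φ : ℕ → Carrier) → k < N → (∀ n → n ≢ k → φ n ≈ 0#) →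
           ∑[ i < N ] φ (toℕ i) ≈ φ k
  sum-δℕ φ k<N φ≈0 =
    trans (sum-δ _ (fromℕ< k<N) (λ i i≢k → φ≈0 _ (λ e → i≢k (toℕ-injective (≡.trans e (≡.sym (toℕ-fromℕ< k<N)))))))
          (reflexive (≡.cong φ (toℕ-fromℕ< k<N)))

  indicator : Bool → Carrier
  indicator b = if b then 1# else 0#

  fromℕ-indicator : (b : Bool) → fromℕ (if b then 1 else 0) ≈ indicator b
  fromℕ-indicator true  = +-identityʳ 1#
  fromℕ-indicator false = reflexive refl

  -- does (a ≟ b) computes to a ≡ᵇ b, so δ agrees definitionally with gCoeffℕ-oneVariable.
  δ : ℕ → ℕ → Carrier
  δ a b = indicator (does (a ≟ b))

  δ-refl : (a : ℕ) → δ a a ≡ 1#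
  δ-refl a = ≡.cong indicator (dec-true (a ≟ a) refl)

  δ-≢ : {a b : ℕ} → a ≢ b → δ a b ≡ 0#
  δ-≢ {a} {b} a≢b = ≡.cong indicator (dec-false (a ≟ b) a≢b)

  δ-cong-⇔ : {a b a′ b′ : ℕ} → (a ≡ b ⇔ a′ ≡ b′) → δ a b ≡ δ a′ b′
  δ-cong-⇔ {a} {b} {a′} {b′} a≡b⇔a′≡b′ = ≡.cong indicator (does-⇔ a≡b⇔a′≡b′ (a ≟ b) (a′ ≟ b′))

  -- f(x₁, 0, 0, …) = x₁ ^ C
  record OneVarMonomial (C : ℕ) (f : Series) : Set ℓ where
    constructor oneVarMonomial
    field coefficient : ∀ n → f (n ∷ []) ≈ δ C n
  open OneVarMonomial

  oneVarMonomial-diag : {C : ℕ} {f : Series} → OneVarMonomial C f → f (C ∷ []) ≈ 1#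
  oneVarMonomial-diag {C} f-mono = trans (coefficient f-mono C) (reflexive (δ-refl C))

  oneVarMonomial-off : {C n : ℕ} {f : Series} → OneVarMonomial C f → n ≢ C → f (n ∷ []) ≈ 0#
  oneVarMonomial-off {C} {n} f-mono n≢C = trans (coefficient f-mono n) (reflexive (δ-≢ (n≢C ∘ ≡.sym)))

  gSkew-oneVarMonomial : (la μ : Partition) → OneVarMonomial (colsSkew la μ) (gSkew la μ)
  gSkew-oneVarMonomial la μ = oneVarMonomial λ n →
    trans (reflexive (≡.cong fromℕ (gCoeffℕ-oneVariable la μ n))) (fromℕ-indicator _)

  g-oneVarMonomial : (la : Partition) → OneVarMonomial (cols la) (g la)
  g-oneVarMonomial la = ≡.subst (λ C → OneVarMonomial C (g la)) (colsSkew-∅ la)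
                                (gSkew-oneVarMonomial la emptyPartition)

  sumK-map-applyUpTo : {A : Set} (φ : A → Carrier) (h : ℕ → A) (m : ℕ) →
                       sumK (map φ (applyUpTo h m)) ≡ ∑[ i < m ] φ (h (toℕ i))
  sumK-map-applyUpTo φ h zero    = refl
  sumK-map-applyUpTo φ h (suc m) = ≡.cong (φ (h 0) +_) (sumK-map-applyUpTo φ (h ∘ suc) m)

  ⋆-oneVarCoefficient : (f h : Series) (n : ℕ) →
                        (f ⋆ h) (n ∷ []) ≡ ∑[ i < suc n ] (f (toℕ i ∷ []) * h ((n ∸ toℕ i) ∷ []))
  ⋆-oneVarCoefficient f h n = ≡.trans (≡.cong (sumK ∘ map product) (splits-singleton n))
                                      (sumK-map-applyUpTo product (splitAt n) (suc n))
    where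
      product : List ℕ × List ℕ → Carrier
      product (β , γ) = f β * h γ

  δ-∸ : {a b n : ℕ} → a ≤ n → δ b (n ∸ a) ≡ δ (a ℕ.+ b) n
  δ-∸ {a} {b} a≤n = δ-cong-⇔ (mk⇔ (λ e → ≡.trans (≡.cong (a ℕ.+_) e) (m+[n∸m]≡n a≤n))
                                 (λ e → ≡.trans (≡.sym (m+n∸m≡n a b)) (≡.cong (_∸ a) e)))

  ⋆-oneVarCoefficient-δ : {a b : ℕ} {f h : Series} → OneVarMonomial a f → OneVarMonomial b h →
                          ∀ n → (f ⋆ h) (n ∷ []) ≈ δ (a ℕ.+ b) n
  ⋆-oneVarCoefficient-δ {a} {b} {f} {h} f-mono h-mono n with a ℕ.≤? n
  ... | yes a≤n = begin
    (f ⋆ h) (n ∷ [])               ≡⟨ ⋆-oneVarCoefficient f h n ⟩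
    ∑[ i < suc n ] term (toℕ i)    ≈⟨ sum-δℕ term (s≤s a≤n) term-off ⟩
    f (a ∷ []) * h ((n ∸ a) ∷ [])  ≈⟨ *-cong (oneVarMonomial-diag f-mono) (coefficient h-mono (n ∸ a)) ⟩
    1# * δ b (n ∸ a)               ≈⟨ *-identityˡ _ ⟩
    δ b (n ∸ a)                    ≡⟨ δ-∸ a≤n ⟩
    δ (a ℕ.+ b) n                  ∎
    where
      term : ℕ → Carrier
      term m = f (m ∷ []) * h ((n ∸ m) ∷ [])
      term-off : ∀ m → m ≢ a → term m ≈ 0#
      term-off m m≢a = trans (*-congʳ (oneVarMonomial-off f-mono m≢a)) (zeroˡ _)
  ... | no a≰n = begin
    (f ⋆ h) (n ∷ [])               ≡⟨ ⋆-oneVarCoefficient f h n ⟩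
    ∑[ i < suc n ] term i          ≈⟨ sum-zero term term-off ⟩
    0#                             ≡⟨ δ-≢ (λ e → a≰n (≡.subst (a ≤_) e (m≤m+n a b))) ⟨
    δ (a ℕ.+ b) n                  ∎
    where
      term : Fin (suc n) → Carrier
      term i = f (toℕ i ∷ []) * h ((n ∸ toℕ i) ∷ [])
      term-off : ∀ i → term i ≈ 0#
      term-off i = trans (*-congʳ (oneVarMonomial-off f-mono (λ e → a≰n (≡.subst (_≤ n) e (toℕ≤pred[n] i)))))
                         (zeroˡ _)

  ⋆-oneVarMonomial : {a b : ℕ} {f h : Series} →
                     OneVarMonomial a f → OneVarMonomial b h → OneVarMonomial (a ℕ.+ b) (f ⋆ h)
  ⋆-oneVarMonomial f-mono h-mono = oneVarMonomial (⋆-oneVarCoefficient-δ f-mono h-mono)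

  specialise : Carrier → ℕ → Series → Carrier
  specialise t N f = ∑[ i < N ] (f (toℕ i ∷ []) * pow t (toℕ i))

  specialise-cong : (t : Carrier) (N : ℕ) {f h : Series} → f ≈ˢ h → specialise t N f ≈ specialise t N h
  specialise-cong t N f≈h = sum-cong-≋ {N} (λ i → *-congʳ (f≈h (toℕ i ∷ [])))

  specialise-oneVarMonomial : (t : Carrier) {C N : ℕ} {f : Series} →
                              OneVarMonomial C f → C < N → specialise t N f ≈ pow t C
  specialise-oneVarMonomial t {C} {N} {f} f-mono C<N = begin
    specialise t N f            ≈⟨ sum-δℕ (λ n → f (n ∷ []) * pow t n) C<N term-off ⟩
    f (C ∷ []) * pow t C        ≈⟨ *-congʳ (oneVarMonomial-diag f-mono) ⟩
    1# * pow t C                ≈⟨ *-identityˡ (pow t C) ⟩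
    pow t C                     ∎
    where
      term-off : ∀ n → n ≢ C → f (n ∷ []) * pow t n ≈ 0#
      term-off n n≢C = trans (*-congʳ (oneVarMonomial-off f-mono n≢C)) (zeroˡ (pow t n))

  specialise-combo-∷ : (t : Carrier) (N : ℕ) (la : Partition) (a : Carrier) (L : List (Partition × Carrier)) →
                       specialise t N (combo ((la , a) ∷ L)) ≈ a * specialise t N (g la) + specialise t N (combo L)
  specialise-combo-∷ t N la a L = begin
    ∑[ i < N ] ((a * gᵢ i + Lᵢ i) * tᵢ i)        ≈⟨ sum-cong-≋ {N} (λ i → distribʳ (tᵢ i) (a * gᵢ i) (Lᵢ i)) ⟩
    ∑[ i < N ] (a * gᵢ i * tᵢ i + Lᵢ i * tᵢ i)   ≈⟨ ∑-distrib-+ (λ i → a * gᵢ i * tᵢ i) (λ i → Lᵢ i * tᵢ i) ⟩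
    ∑[ i < N ] (a * gᵢ i * tᵢ i) + specialise t N (combo L)
      ≈⟨ +-congʳ (trans (sum-cong-≋ {N} (λ i → *-assoc a (gᵢ i) (tᵢ i))) (sym (*-distribˡ-sum a (λ i → gᵢ i * tᵢ i)))) ⟩
    a * specialise t N (g la) + specialise t N (combo L)   ∎
    where
      gᵢ Lᵢ tᵢ : Fin N → Carrier
      gᵢ i = g la (toℕ i ∷ [])
      Lᵢ i = combo L (toℕ i ∷ [])
      tᵢ i = pow t (toℕ i)

  specialise-combo : (t : Carrier) {N : ℕ} (L : List (Partition × Carrier)) →
                     All ((_< N) ∘ cols ∘ proj₁) L → specialise t N (combo L) ≈ comboEval t L
  specialise-combo t {N} []             _                  = sum-zero {N} _ (λ i → zeroˡ _)
  specialise-combo t {N} ((la , a) ∷ L) (cols<N All.∷ L<N) = begin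
    specialise t N (combo ((la , a) ∷ L))                 ≈⟨ specialise-combo-∷ t N la a L ⟩
    a * specialise t N (g la) + specialise t N (combo L)
      ≈⟨ +-cong (*-congˡ (specialise-oneVarMonomial t (g-oneVarMonomial la) cols<N)) (specialise-combo t L L<N) ⟩
    a * pow t (cols la) + comboEval t L                   ∎

  maxCols : List (Partition × Carrier) → ℕ
  maxCols = foldr (λ p m → cols (proj₁ p) ⊔ m) 0

  maxCols-bound : (L : List (Partition × Carrier)) → All ((_≤ maxCols L) ∘ cols ∘ proj₁) L
  maxCols-bound []             = All.[]
  maxCols-bound ((la , a) ∷ L) =
    m≤m⊔n (cols la) (maxCols L) All.∷ All.map (λ le → ≤-trans le (m≤n⊔m (cols la) (maxCols L))) (maxCols-bound L)

  oneVarMonomial⇒pow≈comboEval : (t : Carrier) {C : ℕ} {f : Series} (L : List (Partition × Carrier)) →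
                                 OneVarMonomial C f → f ≈ˢ combo L → pow t C ≈ comboEval t L
  oneVarMonomial⇒pow≈comboEval t {C} {f} L f-mono f≈L = begin
    pow t C                   ≈⟨ specialise-oneVarMonomial t f-mono (s≤s (m≤m⊔n C (maxCols L))) ⟨
    specialise t N f          ≈⟨ specialise-cong t N f≈L ⟩
    specialise t N (combo L)  ≈⟨ specialise-combo t L (All.map (λ le → s≤s (≤-trans le (m≤n⊔m C (maxCols L))))
                                                                (maxCols-bound L)) ⟩
    comboEval t L             ∎
    where
      N = suc (C ⊔ maxCols L)

corollary5p3 : ∀ {c ℓ} (K : CommutativeRing c ℓ) (t : CommutativeRing.Carrier K) →
    let open CommutativeRing K
        open WithRing K
    in ((μ ν : Partition) (L : List (Partition × Carrier)) →
          (g μ ⋆ g ν) ≈ˢ combo L →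
          pow t (cols μ ℕ.+ cols ν) ≈ comboEval t L)
     × ((la μ : Partition) → μ ⊆ₚ la → (L : List (Partition × Carrier)) →
          gSkew la μ ≈ˢ combo L →
          pow t (colsSkew la μ) ≈ comboEval t L)
corollary5p3 K t =
  (λ μ ν L → oneVarMonomial⇒pow≈comboEval K t L
                (⋆-oneVarMonomial K (g-oneVarMonomial K μ) (g-oneVarMonomial K ν))) ,
  (λ la μ _ L → oneVarMonomial⇒pow≈comboEval K t L (gSkew-oneVarMonomial K la μ))
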